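{- Let $E/\mathbb{Q}$ be an elliptic curve with minimal Weierstrass equation $y^2+xy+\delta y=x^3+ax^2+bx+c$, where $\delta\in\{0,1\}$ and $a,b,c\in\mathbb{Z}$, such that $E$ has good reduction at $2$ and $E(\mathbb{Q}_2)[2]=E(\overline{\mathbb{Q}}_2)[2]$. Write $E(\mathbb{Q}_2)[2]=\{\mathcal{O},(\alpha_1,\beta_1),(\alpha_2,\beta_2),(\alpha_3,\beta_3)\}$ with $\alpha_i,\beta_i\in\mathbb{Q}_2$, ordered so that $\mathrm{ord}_2(\beta_1)\le\mathrm{ord}_2(\beta_2)\le\mathrm{ord}_2(\beta_3)$. Then $\mathrm{ord}_2(\alpha_1)=-2$ and $\alpha_2,\alpha_3\in\mathbb{Z}_2$.
   Context: $\mathcal{O}$ is the point at infinity; $\mathrm{ord}_2$ is the $2$-adic valuation. -}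

module Defs where

open import Data.Nat as ℕ using (ℕ; zero; suc)
open import Data.Integer as ℤ using (ℤ; +_; -[1+_])
open import Data.Rational as ℚ using (ℚ)
open import Data.Product using (Σ; _×_; _,_; ∃)
open import Relation.Binary.PropositionalEquality using (_≡_; refl; cong)
open import Relation.Nullary using (¬_)
open import Data.Integer.Tactic.RingSolver using (solve-∀; solve)

-- 2-adic integers ℤ₂ = lim ℤ/2ⁿℤ, as coherent sequences of integer
-- approximations:  seq n is an approximation modulo 2ⁿ, and
-- seq (n+1) ≡ seq n  (mod 2ⁿ), with explicit quotient witnesses.

pow : ℕ → ℤ
pow n = + (2 ℕ.^ n)

record ℤ₂ : Set where
  constructor mkℤ₂
  field
    seq : ℕ → ℤ
    coh : ∀ n → Σ ℤ λ q → seq (suc n) ≡ seq n ℤ.+ q ℤ.* pow n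
open ℤ₂ public

_∣ᵢ_ : ℕ → ℤ → Set
n ∣ᵢ z = Σ ℤ λ q → z ≡ q ℤ.* pow n

infix 4 _≈₂_
_≈₂_ : ℤ₂ → ℤ₂ → Set
x ≈₂ y = ∀ n → n ∣ᵢ (seq x n ℤ.- seq y n)

ι₂ : ℤ → ℤ₂
ι₂ z = mkℤ₂ (λ _ → z) (λ n → ℤ.0ℤ , lem z (pow n))
  where
  lem : ∀ z p → z ≡ z ℤ.+ ℤ.0ℤ ℤ.* p
  lem = solve-∀

infixl 6 _+₂_
infixl 7 _*₂_

_+₂_ : ℤ₂ → ℤ₂ → ℤ₂
x +₂ y = mkℤ₂ (λ n → seq x n ℤ.+ seq y n) c
  where
  c : ∀ n → Σ ℤ λ q → seq x (suc n) ℤ.+ seq y (suc n) ≡ (seq x n ℤ.+ seq y n) ℤ.+ q ℤ.* pow n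
  c n with coh x n | coh y n
  ... | q₁ , e₁ | q₂ , e₂ rewrite e₁ | e₂ = q₁ ℤ.+ q₂ , lem (seq x n) (seq y n) q₁ q₂ (pow n)
    where
    lem : ∀ a b q r p → (a ℤ.+ q ℤ.* p) ℤ.+ (b ℤ.+ r ℤ.* p) ≡ (a ℤ.+ b) ℤ.+ (q ℤ.+ r) ℤ.* p
    lem = solve-∀

_*₂_ : ℤ₂ → ℤ₂ → ℤ₂
x *₂ y = mkℤ₂ (λ n → seq x n ℤ.* seq y n) c
  where
  c : ∀ n → Σ ℤ λ q → seq x (suc n) ℤ.* seq y (suc n) ≡ (seq x n ℤ.* seq y n) ℤ.+ q ℤ.* pow n
  c n with coh x n | coh y n
  ... | q₁ , e₁ | q₂ , e₂ rewrite e₁ | e₂ =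
    q₁ ℤ.* seq y n ℤ.+ seq x n ℤ.* q₂ ℤ.+ q₁ ℤ.* q₂ ℤ.* pow n , lem (seq x n) (seq y n) q₁ q₂ (pow n)
    where
    lem : ∀ a b q r p → (a ℤ.+ q ℤ.* p) ℤ.* (b ℤ.+ r ℤ.* p)
                       ≡ (a ℤ.* b) ℤ.+ (q ℤ.* b ℤ.+ a ℤ.* r ℤ.+ q ℤ.* r ℤ.* p) ℤ.* p
    lem = solve-∀

-₂_ : ℤ₂ → ℤ₂
-₂ x = mkℤ₂ (λ n → ℤ.- seq x n) c
  where
  c : ∀ n → Σ ℤ λ q → ℤ.- seq x (suc n) ≡ ℤ.- seq x n ℤ.+ q ℤ.* pow n
  c n with coh x n
  ... | q , e rewrite e = ℤ.- q , lem (seq x n) q (pow n)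
    where
    lem : ∀ a q p → ℤ.- (a ℤ.+ q ℤ.* p) ≡ ℤ.- a ℤ.+ (ℤ.- q) ℤ.* p
    lem = solve-∀

-- 2-adic numbers ℚ₂ = ℤ₂[1/2]:  a pair (k , u) stands for u / 2ᵏ.

record ℚ₂ : Set where
  constructor _/2^_
  field
    num : ℤ₂
    den : ℕ
open ℚ₂ public

two^₂ : ℕ → ℤ₂
two^₂ k = ι₂ (pow k)

infix 4 _≈_
_≈_ : ℚ₂ → ℚ₂ → Set
(u /2^ k) ≈ (v /2^ m) = u *₂ two^₂ m ≈₂ v *₂ two^₂ k

infixl 6 _+_ _-_
infixl 7 _*_
infixr 8 _^3 _^2

_+_ : ℚ₂ → ℚ₂ → ℚ₂
(u /2^ k) + (v /2^ m) = (u *₂ two^₂ m +₂ v *₂ two^₂ k) /2^ (k ℕ.+ m)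

_*_ : ℚ₂ → ℚ₂ → ℚ₂
(u /2^ k) * (v /2^ m) = (u *₂ v) /2^ (k ℕ.+ m)

-_ : ℚ₂ → ℚ₂
- (u /2^ k) = (-₂ u) /2^ k

_-_ : ℚ₂ → ℚ₂ → ℚ₂
x - y = x + (- y)

_^2 : ℚ₂ → ℚ₂
x ^2 = x * x

_^3 : ℚ₂ → ℚ₂
x ^3 = x * x * x

⟦_⟧ : ℤ → ℚ₂
⟦ z ⟧ = ι₂ z /2^ 0

⟦_⟧₂ : ℤ₂ → ℚ₂
⟦ u ⟧₂ = u /2^ 0

2^ : ℤ → ℚ₂
2^ (+ n)      = ⟦ pow n ⟧
2^ (-[1+ n ]) = ι₂ (+ 1) /2^ (suc n)

-- ord₂ x ≥ m   (i.e. x ∈ 2^m ℤ₂; holds for all m when x = 0, ord₂ 0 = ∞)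
ord₂≥ : ℚ₂ → ℤ → Set
ord₂≥ x m = Σ ℤ₂ λ w → x ≈ 2^ m * ⟦ w ⟧₂

ord₂_≤ord₂_ : ℚ₂ → ℚ₂ → Set
ord₂ x ≤ord₂ y = ∀ m → ord₂≥ x m → ord₂≥ y m

ord₂_≡_ : ℚ₂ → ℤ → Set
ord₂ x ≡ m = ord₂≥ x m × ¬ ord₂≥ x (m ℤ.+ ℤ.1ℤ)

_∈ℤ₂ : ℚ₂ → Set
x ∈ℤ₂ = ord₂≥ x ℤ.0ℤ

-- The Weierstrass equation  y² + xy + δy = x³ + ax² + bx + c
-- (a₁ = 1, a₂ = a, a₃ = δ, a₄ = b, a₆ = c).

record Weierstrass : Set where
  constructor W
  field
    δ a b c : ℤ
open Weierstrass public

disc : Weierstrass → ℤ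
disc (W δ a b c) =
  ℤ.- (b₂ ℤ.* b₂ ℤ.* b₈) ℤ.- + 8 ℤ.* b₄ ℤ.* b₄ ℤ.* b₄ ℤ.- + 27 ℤ.* b₆ ℤ.* b₆ ℤ.+ + 9 ℤ.* b₂ ℤ.* b₄ ℤ.* b₆
  where
  b₂ = + 1 ℤ.+ + 4 ℤ.* a
  b₄ = + 2 ℤ.* b ℤ.+ δ
  b₆ = δ ℤ.* δ ℤ.+ + 4 ℤ.* c
  b₈ = c ℤ.+ + 4 ℤ.* a ℤ.* c ℤ.- δ ℤ.* b ℤ.+ a ℤ.* δ ℤ.* δ ℤ.- b ℤ.* b

-- Global minimality: no change of variables x = u²x' + r, y = u³y' + su²x' + t
-- (u, r, s, t ∈ ℚ, u ≠ 0) yields a model with integral coefficients and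
-- strictly smaller |Δ| (Δ' = u⁻¹² Δ), i.e. |u| > 1.
-- q / v ∈ ℤ   (for v ≠ 0), written multiplicatively:  q = v · n  with n ∈ ℤ
IsIntℚ : ℚ → ℚ → Set
IsIntℚ q v = Σ ℤ λ n → q ≡ v ℚ.* (n ℚ./ 1)

IntegralChange : Weierstrass → ℚ → ℚ → ℚ → ℚ → Set
IntegralChange (W δ' a' b' c') u r s t =
    IsIntℚ (a₁ ℚ.+ twoℚ ℚ.* s) u
  × IsIntℚ (a₂ ℚ.- s ℚ.* a₁ ℚ.+ threeℚ ℚ.* r ℚ.- s ℚ.* s) (u ℚ.* u)
  × IsIntℚ (a₃ ℚ.+ r ℚ.* a₁ ℚ.+ twoℚ ℚ.* t) (u ℚ.* u ℚ.* u)
  × IsIntℚ (a₄ ℚ.- s ℚ.* a₃ ℚ.+ twoℚ ℚ.* r ℚ.* a₂ ℚ.- (t ℚ.+ r ℚ.* s) ℚ.* a₁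
             ℚ.+ threeℚ ℚ.* r ℚ.* r ℚ.- twoℚ ℚ.* s ℚ.* t) (u ℚ.* u ℚ.* u ℚ.* u)
  × IsIntℚ (a₆ ℚ.+ r ℚ.* a₄ ℚ.+ r ℚ.* r ℚ.* a₂ ℚ.+ r ℚ.* r ℚ.* r ℚ.- t ℚ.* a₃
             ℚ.- t ℚ.* t ℚ.- r ℚ.* t ℚ.* a₁) (u ℚ.* u ℚ.* u ℚ.* u ℚ.* u ℚ.* u)
  where
  a₁ = ℚ.1ℚ
  a₂ = a' ℚ./ 1
  a₃ = δ' ℚ./ 1
  a₄ = b' ℚ./ 1
  a₆ = c' ℚ./ 1
  twoℚ = + 2 ℚ./ 1
  threeℚ = + 3 ℚ./ 1

IsMinimal : Weierstrass → Set
IsMinimal E = ∀ (u r s t : ℚ) → ¬ (u ≡ ℚ.0ℚ) → IntegralChange E u r s t → ℚ.∣ u ∣ ℚ.≤ ℚ.1ℚ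

-- Good reduction at 2 (for a minimal model): 2 ∤ Δ
GoodAt2 : Weierstrass → Set
GoodAt2 E = ¬ (Σ ℤ λ q → disc E ≡ q ℤ.* + 2)

OnCurve : Weierstrass → ℚ₂ → ℚ₂ → Set
OnCurve (W δ a b c) x y =
  y ^2 + x * y + ⟦ δ ⟧ * y ≈ x ^3 + ⟦ a ⟧ * x ^2 + ⟦ b ⟧ * x + ⟦ c ⟧

-- negation on E:  -(x , y) = (x , -y - a₁x - a₃) = (x , -y - x - δ).
-- An affine point P has [2]P = 𝒪 iff P = -P.
Is2Torsion : Weierstrass → ℚ₂ → ℚ₂ → Set
Is2Torsion E@(W δ a b c) x y = OnCurve E x y × (y ≈ - y - x - ⟦ δ ⟧)

DistinctPts : ℚ₂ → ℚ₂ → ℚ₂ → ℚ₂ → Set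
DistinctPts x y x' y' = ¬ (x ≈ x' × y ≈ y')

-- Substituting 2y = −x − δ into the curve equation shows that the x-coordinate of a 2-torsion
-- point is a root of f = 4x³ + b₂x² + 2b₄x + b₆, where b₂ = 1 + 4a is odd.  For x = w/2ˢ⁺¹ with
-- w a unit, 2³⁽ˢ⁺¹⁾ f(x) is ≡ 2 (mod 4) when s = 0 and ≡ 4 (mod 8) when s ≥ 2, so every root is
-- integral or of valuation exactly −2.  Two roots w/4, w′/4 of the second kind satisfy
-- (w − w′)·4·(unit) = 0, and three integral roots satisfy (x₂ − x₃)(4(x₁ + x₂ + x₃) + b₂) = 0;
-- since ℤ₂ is a domain both contradict distinctness.  As 2β = −α − δ, α is integral exactly when
-- ord₂ β ≥ −1, so the root of valuation −2 is α₁.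

module Submission where

open import Defs hiding (_+_; _*_; -_; _-_)
import Defs as D
open import Data.Nat as ℕ using (ℕ; zero; suc; s≤s)
import Data.Nat.Properties as ℕP
open import Data.Integer using (ℤ; +_; -[1+_]; _+_; _*_; -_; _-_; 0ℤ; 1ℤ)
import Data.Integer.Properties as ℤP
open import Data.Integer.DivMod using (_%ℕ_; _/ℕ_; n%ℕd<d; a≡a%ℕn+[a/ℕn]*n)
open import Data.Integer.Tactic.RingSolver using (solve-∀)
open import Data.Product using (Σ; _×_; _,_; proj₁; proj₂)
open import Data.Sum using (_⊎_; inj₁; inj₂)
open import Data.Empty using (⊥; ⊥-elim)
open import Function using (_∘_)
open import Relation.Nullary using (¬_; Dec; yes; no)
open import Relation.Binary.PropositionalEquality
open ≡-Reasoning

pow-+ : ∀ m n → pow (m ℕ.+ n) ≡ pow m * pow n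
pow-+ m n = trans (cong +_ (ℕP.^-distribˡ-+-* 2 m n)) (ℤP.pos-* (2 ℕ.^ m) (2 ℕ.^ n))

pow-suc : ∀ n → pow (suc n) ≡ + 2 * pow n
pow-suc n = ℤP.pos-* 2 (2 ℕ.^ n)

pow-*3 : ∀ k → pow (k ℕ.+ k ℕ.+ k) ≡ pow k * pow k * pow k
pow-*3 k = trans (pow-+ (k ℕ.+ k) k) (cong (_* pow k) (pow-+ k k))

-- Divisibility by powers of 2

0∣ᵢ : ∀ a → 0 ∣ᵢ a
0∣ᵢ a = a , sym (ℤP.*-identityʳ a)

∣ᵢ-refl : ∀ n → n ∣ᵢ pow n
∣ᵢ-refl n = 1ℤ , sym (ℤP.*-identityˡ (pow n))

∣ᵢ-lincomb₁ : ∀ n {a t} p → n ∣ᵢ a → t ≡ p * a → n ∣ᵢ t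
∣ᵢ-lincomb₁ n p (x , refl) refl = p * x , sym (ℤP.*-assoc p x (pow n))

∣ᵢ-lincomb₂ : ∀ n {a b t} p q → n ∣ᵢ a → n ∣ᵢ b → t ≡ p * a + q * b → n ∣ᵢ t
∣ᵢ-lincomb₂ n p q (x , refl) (y , refl) refl = p * x + q * y , ring p q x y (pow n)
  where
  ring : ∀ p q x y P → p * (x * P) + q * (y * P) ≡ (p * x + q * y) * P
  ring = solve-∀

∣ᵢ-lincomb₃ : ∀ n {a b c t} p q r → n ∣ᵢ a → n ∣ᵢ b → n ∣ᵢ c → t ≡ p * a + q * b + r * c → n ∣ᵢ t
∣ᵢ-lincomb₃ n p q r (x , refl) (y , refl) (z , refl) refl = p * x + q * y + r * z , ring p q r x y z (pow n)
  where
  ring : ∀ p q r x y z P → p * (x * P) + q * (y * P) + r * (z * P) ≡ (p * x + q * y + r * z) * P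
  ring = solve-∀

∣ᵢ-weaken : ∀ n j {a} → (n ℕ.+ j) ∣ᵢ a → n ∣ᵢ a
∣ᵢ-weaken n j (q , refl) = q * pow j , (begin
  q * pow (n ℕ.+ j)    ≡⟨ cong (q *_) (trans (pow-+ n j) (ℤP.*-comm (pow n) (pow j))) ⟩
  q * (pow j * pow n)  ≡⟨ ℤP.*-assoc q (pow j) (pow n) ⟨
  q * pow j * pow n    ∎)

∣ᵢ-cancel-pow : ∀ n s {a} → (n ℕ.+ s) ∣ᵢ (pow s * a) → n ∣ᵢ a
∣ᵢ-cancel-pow n s {a} (q , e) = q , ℤP.*-cancelʳ-≡ a (q * pow n) (pow s) {{ℕP.m^n≢0 2 s}} (begin
  a * pow s              ≡⟨ ℤP.*-comm a (pow s) ⟩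
  pow s * a              ≡⟨ e ⟩
  q * pow (n ℕ.+ s)      ≡⟨ cong (q *_) (pow-+ n s) ⟩
  q * (pow n * pow s)    ≡⟨ ℤP.*-assoc q (pow n) (pow s) ⟨
  q * pow n * pow s      ∎)

Even Odd : ℤ → Set
Even z = Σ ℤ λ q → z ≡ q * + 2
Odd z = Σ ℤ λ q → z ≡ 1ℤ + q * + 2

1≢even : ∀ t → 1ℤ ≢ t * + 2
1≢even (+ zero) ()
1≢even (+ suc n) ()
1≢even -[1+ n ] ()

even⇒¬odd : ∀ {z} → Even z → ¬ Odd z
even⇒¬odd {z} (p , z≡2p) (q , z≡1+2q) = 1≢even (p - q) (begin
  1ℤ                      ≡⟨ ring₁ q ⟩
  1ℤ + q * + 2 - q * + 2  ≡⟨ cong (_- q * + 2) (trans (sym z≡1+2q) z≡2p) ⟩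
  p * + 2 - q * + 2       ≡⟨ ring₂ p q ⟩
  (p - q) * + 2           ∎)
  where
  ring₁ : ∀ q → 1ℤ ≡ 1ℤ + q * + 2 - q * + 2
  ring₁ = solve-∀
  ring₂ : ∀ p q → p * + 2 - q * + 2 ≡ (p - q) * + 2
  ring₂ = solve-∀

parity : ∀ z → Even z ⊎ Odd z
parity z with z %ℕ 2 | n%ℕd<d z 2 | a≡a%ℕn+[a/ℕn]*n z 2
... | 0 | _ | e = inj₁ (z /ℕ 2 , trans e (ℤP.+-identityˡ _))
... | 1 | _ | e = inj₂ (z /ℕ 2 , e)
... | suc (suc _) | s≤s (s≤s ()) | _

odd-* : ∀ {a b} → Odd a → Odd b → Odd (a * b)
odd-* (r , refl) (s , refl) = r + s + r * s * + 2 , ring r s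
  where
  ring : ∀ r s → (1ℤ + r * + 2) * (1ℤ + s * + 2) ≡ 1ℤ + (r + s + r * s * + 2) * + 2
  ring = solve-∀

∣ᵢ⇒suc∣ᵢ-*2 : ∀ n h → n ∣ᵢ h → suc n ∣ᵢ (h * + 2)
∣ᵢ⇒suc∣ᵢ-*2 n h (q , refl) =
  q , trans (ℤP.*-assoc q (pow n) (+ 2)) (cong (q *_) (trans (ℤP.*-comm (pow n) (+ 2)) (sym (pow-suc n))))

suc∣ᵢ-*2⇒∣ᵢ : ∀ n h → suc n ∣ᵢ (h * + 2) → n ∣ᵢ h
suc∣ᵢ-*2⇒∣ᵢ n h d =
  ∣ᵢ-cancel-pow n 1 (∣ᵢ-lincomb₁ (n ℕ.+ 1) 1ℤ (subst (_∣ᵢ (h * + 2)) (ℕP.+-comm 1 n) d) (ring h))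
  where
  ring : ∀ h → + 2 * h ≡ 1ℤ * (h * + 2)
  ring = solve-∀

suc-∣ᵢ⇒even : ∀ n z → suc n ∣ᵢ z → Even z
suc-∣ᵢ⇒even n z = ∣ᵢ-weaken 1 n

_∣ᵢ?_ : ∀ n z → Dec (n ∣ᵢ z)
zero ∣ᵢ? z = yes (0∣ᵢ z)
suc n ∣ᵢ? z with parity z
... | inj₂ o = no (λ d → even⇒¬odd (suc-∣ᵢ⇒even n z d) o)
... | inj₁ (h , refl) with n ∣ᵢ? h
...   | yes d = yes (∣ᵢ⇒suc∣ᵢ-*2 n h d)
...   | no ¬d = no (λ d → ¬d (suc∣ᵢ-*2⇒∣ᵢ n h d))

∣ᵢ-cancel-odd : ∀ n {a b} → Odd b → n ∣ᵢ (a * b) → n ∣ᵢ a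
∣ᵢ-cancel-odd zero {a} ob d = 0∣ᵢ a
∣ᵢ-cancel-odd (suc n) {a} {b} ob d with parity a
... | inj₂ oa = ⊥-elim (even⇒¬odd (suc-∣ᵢ⇒even n (a * b) d) (odd-* oa ob))
... | inj₁ (h , refl) =
  ∣ᵢ⇒suc∣ᵢ-*2 n h (∣ᵢ-cancel-odd n ob (suc∣ᵢ-*2⇒∣ᵢ n (h * b) (subst (suc n ∣ᵢ_) (ring h b) d)))
  where
  ring : ∀ h b → h * + 2 * b ≡ h * b * + 2
  ring = solve-∀

∤ᵢ-* : ∀ m n {a b} → ¬ m ∣ᵢ a → ¬ n ∣ᵢ b → ¬ (m ℕ.+ n) ∣ᵢ (a * b)
∤ᵢ-* zero n {a} ¬m∣a ¬n∣b d = ¬m∣a (0∣ᵢ a)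
∤ᵢ-* (suc m) n {a} {b} ¬m∣a ¬n∣b d with parity a
... | inj₂ oa = ¬n∣b (∣ᵢ-cancel-odd n oa (subst (n ∣ᵢ_) (ℤP.*-comm a b)
                  (∣ᵢ-weaken n (suc m) (subst (_∣ᵢ (a * b)) (ℕP.+-comm (suc m) n) d))))
... | inj₁ (h , refl) = ∤ᵢ-* m n (λ d′ → ¬m∣a (∣ᵢ⇒suc∣ᵢ-*2 m h d′)) ¬n∣b
                          (suc∣ᵢ-*2⇒∣ᵢ (m ℕ.+ n) (h * b) (subst (suc (m ℕ.+ n) ∣ᵢ_) (ring h b) d))
  where
  ring : ∀ h b → h * + 2 * b ≡ h * b * + 2
  ring = solve-∀

pow*odd-∤ᵢ : ∀ n {t} e → t ≡ pow n * (1ℤ + e * + 2) → ¬ suc n ∣ᵢ t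
pow*odd-∤ᵢ n e refl d = even⇒¬odd (∣ᵢ-cancel-pow 1 n d) (e , refl)

-- 2-adic integers

infixl 6 _-₂_
_-₂_ : ℤ₂ → ℤ₂ → ℤ₂
x -₂ y = x +₂ -₂ y

IsZero₂ : ℤ₂ → Set
IsZero₂ x = ∀ n → n ∣ᵢ seq x n

IsZero₂-resp : ∀ x y → (∀ n → seq y n ≡ seq x n) → IsZero₂ x → IsZero₂ y
IsZero₂-resp x y y≡x x=0 n = ∣ᵢ-lincomb₁ n 1ℤ (x=0 n) (trans (y≡x n) (sym (ℤP.*-identityˡ _)))

seq-coherent : ∀ x n j → n ∣ᵢ (seq x (n ℕ.+ j) - seq x n)
seq-coherent x n zero rewrite ℕP.+-identityʳ n = 0ℤ , trans (ℤP.+-inverseʳ (seq x n)) (sym (ℤP.*-zeroˡ (pow n)))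
seq-coherent x n (suc j) rewrite ℕP.+-suc n j with coh x (n ℕ.+ j)
... | q , e = ∣ᵢ-lincomb₂ n 1ℤ (q * pow j) (seq-coherent x n j) (∣ᵢ-refl n) (begin
  seq x (suc (n ℕ.+ j)) - seq x n                  ≡⟨ cong (_- seq x n) e ⟩
  seq x (n ℕ.+ j) + q * pow (n ℕ.+ j) - seq x n    ≡⟨ cong (λ P → seq x (n ℕ.+ j) + q * P - seq x n) (pow-+ n j) ⟩
  seq x (n ℕ.+ j) + q * (pow n * pow j) - seq x n  ≡⟨ ring (seq x (n ℕ.+ j)) (seq x n) q (pow n) (pow j) ⟩
  1ℤ * (seq x (n ℕ.+ j) - seq x n) + q * pow j * pow n ∎)
  where
  ring : ∀ a b q p r → a + q * (p * r) - b ≡ 1ℤ * (a - b) + q * r * p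
  ring = solve-∀

∣ᵢ-seq-lower : ∀ x n j → n ∣ᵢ seq x (n ℕ.+ j) → n ∣ᵢ seq x n
∣ᵢ-seq-lower x n j d = ∣ᵢ-lincomb₂ n 1ℤ (- 1ℤ) d (seq-coherent x n j) (ring (seq x (n ℕ.+ j)) (seq x n))
  where
  ring : ∀ a b → b ≡ 1ℤ * a + - 1ℤ * (a - b)
  ring = solve-∀

IsZero₂-cancel-pow : ∀ s x → IsZero₂ (two^₂ s *₂ x) → IsZero₂ x
IsZero₂-cancel-pow s x 2ˢx=0 n = ∣ᵢ-seq-lower x n s (∣ᵢ-cancel-pow n s (2ˢx=0 (n ℕ.+ s)))

odd⇒¬IsZero₂ : ∀ x → Odd (seq x 1) → ¬ IsZero₂ x
odd⇒¬IsZero₂ x o x=0 = even⇒¬odd (x=0 1) o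

IsZero₂-*-cancelʳ : ∀ x y → ¬ IsZero₂ y → IsZero₂ (x *₂ y) → IsZero₂ x
IsZero₂-*-cancelʳ x y y≠0 xy=0 m with m ∣ᵢ? seq x m
... | yes d = d
... | no ¬d = ⊥-elim (y≠0 y=0)
  where
  y=0 : IsZero₂ y
  y=0 n with n ∣ᵢ? seq y n
  ... | yes d = d
  ... | no ¬d′ = ⊥-elim (∤ᵢ-* m n (¬d ∘ ∣ᵢ-seq-lower x m n)
                           (¬d′ ∘ ∣ᵢ-seq-lower y n m ∘ subst (λ i → n ∣ᵢ seq y i) (ℕP.+-comm m n))
                           (xy=0 (m ℕ.+ n)))

IsZero₂-*-cancelˡ : ∀ x y → ¬ IsZero₂ x → IsZero₂ (x *₂ y) → IsZero₂ y
IsZero₂-*-cancelˡ x y x≠0 xy=0 =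
  IsZero₂-*-cancelʳ y x x≠0 (IsZero₂-resp (x *₂ y) (y *₂ x) (λ n → ℤP.*-comm (seq y n) (seq x n)) xy=0)

seq-suc≡seq-1-mod-2 : ∀ x n → Σ ℤ λ q → seq x (suc n) ≡ seq x 1 + q * + 2
seq-suc≡seq-1-mod-2 x n with seq-coherent x 1 n
... | q , e = q , ring (seq x (suc n)) (seq x 1) q e
  where
  ring : ∀ a b q → a - b ≡ q * + 2 → a ≡ b + q * + 2
  ring a b q e = trans (solve′ a b) (cong (λ t → b + t) e)
    where
    solve′ : ∀ a b → a ≡ b + (a - b)
    solve′ = solve-∀

odd-seq : ∀ x → Odd (seq x 1) → ∀ n → Odd (seq x (suc n))
odd-seq x (r , e) n with seq-suc≡seq-1-mod-2 x n
... | q , e′ = r + q , trans e′ (trans (cong (_+ q * + 2) e) (ring r q))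
  where
  ring : ∀ r q → 1ℤ + r * + 2 + q * + 2 ≡ 1ℤ + (r + q) * + 2
  ring = solve-∀

even-seq : ∀ x → Even (seq x 1) → ∀ n → Even (seq x (suc n))
even-seq x (r , e) n with seq-suc≡seq-1-mod-2 x n
... | q , e′ = r + q , trans e′ (trans (cong (_+ q * + 2) e) (sym (ℤP.*-distribʳ-+ (+ 2) r q)))

halve : ∀ x → Even (seq x 1) → Σ ℤ₂ λ y → x ≈₂ two^₂ 1 *₂ y
halve x ev = mkℤ₂ half half-coh , x≈2half
  where
  half : ℕ → ℤ
  half n = proj₁ (even-seq x ev n)

  half-*2 : ∀ n → seq x (suc n) ≡ half n * + 2
  half-*2 n = proj₂ (even-seq x ev n)

  ring₁ : ∀ h r P → h * + 2 + r * (+ 2 * P) ≡ (h + r * P) * + 2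
  ring₁ = solve-∀

  ring₂ : ∀ a q P → a - (a + q * P) ≡ - q * P
  ring₂ = solve-∀

  half-coh′ : ∀ n → (Σ ℤ λ r → seq x (suc (suc n)) ≡ seq x (suc n) + r * pow (suc n))
            → Σ ℤ λ q → half (suc n) ≡ half n + q * pow n
  half-coh′ n (r , e) = r , ℤP.*-cancelʳ-≡ (half (suc n)) (half n + r * pow n) (+ 2) (begin
    half (suc n) * + 2                ≡⟨ sym (half-*2 (suc n)) ⟩
    seq x (suc (suc n))               ≡⟨ e ⟩
    seq x (suc n) + r * pow (suc n)   ≡⟨ cong₂ (λ s P → s + r * P) (half-*2 n) (pow-suc n) ⟩
    half n * + 2 + r * (+ 2 * pow n)  ≡⟨ ring₁ (half n) r (pow n) ⟩
    (half n + r * pow n) * + 2        ∎)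

  half-coh : ∀ n → Σ ℤ λ q → half (suc n) ≡ half n + q * pow n
  half-coh n = half-coh′ n (coh x (suc n))

  x≈2half′ : ∀ n → (Σ ℤ λ q → seq x (suc n) ≡ seq x n + q * pow n) → n ∣ᵢ (seq x n - + 2 * half n)
  x≈2half′ n (q , e) = ∣ᵢ-lincomb₁ n (- q) (∣ᵢ-refl n) (begin
    seq x n - + 2 * half n           ≡⟨ cong (λ t → seq x n - t) (trans (ℤP.*-comm (+ 2) (half n)) (sym (half-*2 n))) ⟩
    seq x n - seq x (suc n)          ≡⟨ cong (λ t → seq x n - t) e ⟩
    seq x n - (seq x n + q * pow n)  ≡⟨ ring₂ (seq x n) q (pow n) ⟩
    - q * pow n                      ∎)

  x≈2half : ∀ n → n ∣ᵢ (seq x n - + 2 * half n)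
  x≈2half n = x≈2half′ n (coh x n)

-- Equality of 2-adic numbers

≈-refl : ∀ {α} → α ≈ α
≈-refl {u /2^ k} n = 0ℤ , trans (ℤP.+-inverseʳ (seq u n * pow k)) (sym (ℤP.*-zeroˡ (pow n)))

≈-sym : ∀ {α β} → α ≈ β → β ≈ α
≈-sym {u /2^ k} {v /2^ l} α≈β n = ∣ᵢ-lincomb₁ n (- 1ℤ) (α≈β n) (ring (seq u n) (seq v n) (pow k) (pow l))
  where
  ring : ∀ u v K L → v * K - u * L ≡ - 1ℤ * (u * L - v * K)
  ring = solve-∀

≈-trans : ∀ {α β γ} → α ≈ β → β ≈ γ → α ≈ γ
≈-trans {u /2^ k} {v /2^ l} {w /2^ m} α≈β β≈γ = IsZero₂-cancel-pow l (u *₂ two^₂ m -₂ w *₂ two^₂ k) λ n →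
  ∣ᵢ-lincomb₂ n (pow m) (pow k) (α≈β n) (β≈γ n) (ring (seq u n) (seq v n) (seq w n) (pow k) (pow l) (pow m))
  where
  ring : ∀ u v w K L M → L * (u * M - w * K) ≡ M * (u * L - v * K) + K * (v * M - w * L)
  ring = solve-∀

/2^-cong : ∀ {x y} k → x ≈₂ y → (x /2^ k) ≈ (y /2^ k)
/2^-cong {x} {y} k x≈y n = ∣ᵢ-lincomb₁ n (pow k) (x≈y n) (ring (seq x n) (seq y n) (pow k))
  where
  ring : ∀ x y K → x * K - y * K ≡ K * (x - y)
  ring = solve-∀

≈-via-≈₂ : ∀ {α β x y} k → α ≈ (x /2^ k) → β ≈ (y /2^ k) → x ≈₂ y → α ≈ β
≈-via-≈₂ {α} {β} {x} {y} k α≈x β≈y x≈y =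
  ≈-trans {α} {x /2^ k} {β} α≈x (≈-trans {x /2^ k} {y /2^ k} {β} (/2^-cong {x} {y} k x≈y) (≈-sym {β} {y /2^ k} β≈y))

≈-halve : ∀ {u y k β} → u ≈₂ two^₂ 1 *₂ y → (y /2^ k) ≈ β → (u /2^ suc k) ≈ β
≈-halve {u} {y} {k} {w /2^ m} u≈2y y/2ᵏ≈β n = ∣ᵢ-lincomb₂ n (pow m) (+ 2) (u≈2y n) (y/2ᵏ≈β n)
  (trans (cong (λ P → seq u n * pow m - seq w n * P) (pow-suc k)) (ring (seq u n) (seq y n) (seq w n) (pow k) (pow m)))
  where
  ring : ∀ u y w K M → u * M - w * (+ 2 * K) ≡ M * (u - + 2 * y) + + 2 * (y * M - w * K)
  ring = solve-∀

Unit/2^suc : ℚ₂ → Set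
Unit/2^suc α = Σ ℤ₂ λ w → Σ ℕ λ s → Odd (seq w 1) × α ≈ (w /2^ suc s)

∈ℤ₂⊎unit/2^suc : ∀ u k → (u /2^ k) ∈ℤ₂ ⊎ Unit/2^suc (u /2^ k)
∈ℤ₂⊎unit/2^suc u zero = inj₁ (u , λ n → ∣ᵢ-lincomb₁ n 0ℤ (∣ᵢ-refl n) (ring (seq u n) (pow n)))
  where
  ring : ∀ u P → u * + 1 - + 1 * u * + 1 ≡ 0ℤ * P
  ring = solve-∀
∈ℤ₂⊎unit/2^suc u (suc k) = by-parity (parity (seq u 1))
  where
  double : ∀ {y} → u ≈₂ two^₂ 1 *₂ y → (y /2^ k) ∈ℤ₂ ⊎ Unit/2^suc (y /2^ k)
         → (u /2^ suc k) ∈ℤ₂ ⊎ Unit/2^suc (u /2^ suc k)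
  double {y} u≈2y (inj₁ (w , y/2ᵏ≈w)) = inj₁ (w , ≈-halve {u} {y} {k} {2^ 0ℤ D.* ⟦ w ⟧₂} u≈2y y/2ᵏ≈w)
  double {y} u≈2y (inj₂ (w , s , w-odd , y/2ᵏ≈w/2ˢ⁺¹)) =
    inj₂ (w , s , w-odd , ≈-halve {u} {y} {k} {w /2^ suc s} u≈2y y/2ᵏ≈w/2ˢ⁺¹)

  by-parity : Even (seq u 1) ⊎ Odd (seq u 1) → (u /2^ suc k) ∈ℤ₂ ⊎ Unit/2^suc (u /2^ suc k)
  by-parity (inj₂ u-odd) = inj₂ (u , k , u-odd , ≈-refl {u /2^ suc k})
  by-parity (inj₁ u-even) = let (y , u≈2y) = halve u u-even in double {y} u≈2y (∈ℤ₂⊎unit/2^suc y k)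

-- The 2-division polynomial

b₂ b₄ b₆ : Weierstrass → ℤ
b₂ E = 1ℤ + + 4 * a E
b₄ E = + 2 * b E + δ E
b₆ E = δ E * δ E + + 4 * c E

-- 2³ᵏ (4x³ + b₂x² + 2b₄x + b₆) at x = u/2ᵏ
divPoly : Weierstrass → ℚ₂ → ℤ₂
divPoly E (u /2^ k) = ι₂ (+ 4) *₂ u *₂ u *₂ u +₂ ι₂ (b₂ E * K) *₂ u *₂ u
                      +₂ ι₂ (+ 2 * b₄ E * K * K) *₂ u +₂ ι₂ (b₆ E * K * K * K)
  where K = pow k

IsRoot : Weierstrass → ℚ₂ → Set
IsRoot E α = IsZero₂ (divPoly E α)

-- 2ᵏ⁺ᵐ (2y + x + δ) at x = u/2ᵏ, y = v/2ᵐ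
torsionForm : Weierstrass → ℚ₂ → ℚ₂ → ℤ₂
torsionForm E (u /2^ k) (v /2^ m) = ι₂ (+ 2) *₂ v *₂ two^₂ k +₂ u *₂ two^₂ m +₂ ι₂ (δ E * pow m * pow k)

torsionForm≈0 : ∀ E α β → β ≈ D.- β D.- α D.- ⟦ δ E ⟧ → IsZero₂ (torsionForm E α β)
torsionForm≈0 E (u /2^ k) (v /2^ m) β≈-β-α-δ = IsZero₂-cancel-pow m (torsionForm E (u /2^ k) (v /2^ m)) λ n →
  ∣ᵢ-lincomb₁ n 1ℤ (β≈-β-α-δ n)
    (ring (seq v n) (seq u n) (δ E) (pow k) (pow m) (cong pow (ℕP.+-identityʳ (m ℕ.+ k))) (pow-+ m k))
  where
  ring : ∀ v u d K P {Q₀ Q} → Q₀ ≡ Q → Q ≡ P * K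
       → P * (+ 2 * v * K + u * P + d * P * K)
       ≡ 1ℤ * (v * Q₀ - (((- v) * K + (- u) * P) * + 1 + (- d) * Q) * P)
  ring v u d K P refl refl = solve′ v u d K P
    where
    solve′ : ∀ v u d K P → P * (+ 2 * v * K + u * P + d * P * K)
           ≡ 1ℤ * (v * (P * K) - (((- v) * K + (- u) * P) * + 1 + (- d) * (P * K)) * P)
    solve′ = solve-∀

-- 2³ᵏ⁺²ᵐ (y² + xy + δy − x³ − ax² − bx − c) at x = u/2ᵏ, y = v/2ᵐ
curveForm : Weierstrass → ℚ₂ → ℚ₂ → ℤ₂
curveForm E (u /2^ k) (v /2^ m) =
  ι₂ (K * K * K) *₂ v *₂ v +₂ ι₂ (K * K * P) *₂ u *₂ v +₂ ι₂ (δ E * K * K * K * P) *₂ v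
  -₂ ι₂ (P * P) *₂ u *₂ u *₂ u -₂ ι₂ (a E * K * P * P) *₂ u *₂ u -₂ ι₂ (b E * K * K * P * P) *₂ u
  -₂ ι₂ (c E * K * K * K * P * P)
  where
  K = pow k
  P = pow m

on-curve⇒curveForm≈0 : ∀ E α β → OnCurve E α β → IsZero₂ (curveForm E α β)
on-curve⇒curveForm≈0 E (u /2^ k) (v /2^ m) on-curve =
  IsZero₂-cancel-pow (k ℕ.+ k ℕ.+ k ℕ.+ k ℕ.+ (m ℕ.+ m)) (curveForm E (u /2^ k) (v /2^ m)) λ n →
    ∣ᵢ-lincomb₁ n 1ℤ (on-curve n) (ring (seq u n) (seq v n) (δ E) (a E) (b E) (c E) 2ˢ P² KP P²KP K³ K⁵ K⁶ K⁶′ P⁴K K²)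
  where
  K = pow k
  P = pow m
  2ˢ : pow (k ℕ.+ k ℕ.+ k ℕ.+ k ℕ.+ (m ℕ.+ m)) ≡ K * K * K * K * (P * P)
  2ˢ = trans (pow-+ (k ℕ.+ k ℕ.+ k ℕ.+ k) (m ℕ.+ m))
             (cong₂ _*_ (trans (pow-+ (k ℕ.+ k ℕ.+ k) k) (cong (_* K) (pow-*3 k))) (pow-+ m m))
  P² : pow (m ℕ.+ m) ≡ P * P
  P² = pow-+ m m
  KP : pow (k ℕ.+ m) ≡ K * P
  KP = pow-+ k m
  P²KP : pow ((m ℕ.+ m) ℕ.+ (k ℕ.+ m)) ≡ P * P * (K * P)
  P²KP = trans (pow-+ (m ℕ.+ m) (k ℕ.+ m)) (cong₂ _*_ P² KP)
  K³ : pow (k ℕ.+ k ℕ.+ k) ≡ K * K * K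
  K³ = pow-*3 k
  K² : pow (k ℕ.+ k) ≡ K * K
  K² = pow-+ k k
  K⁵ : pow ((k ℕ.+ k ℕ.+ k) ℕ.+ (k ℕ.+ k)) ≡ K * K * K * (K * K)
  K⁵ = trans (pow-+ (k ℕ.+ k ℕ.+ k) (k ℕ.+ k)) (cong₂ _*_ K³ K²)
  K⁶ : pow ((k ℕ.+ k ℕ.+ k) ℕ.+ (k ℕ.+ k) ℕ.+ k) ≡ K * K * K * (K * K) * K
  K⁶ = trans (pow-+ ((k ℕ.+ k ℕ.+ k) ℕ.+ (k ℕ.+ k)) k) (cong (_* K) K⁵)
  K⁶′ : pow ((k ℕ.+ k ℕ.+ k) ℕ.+ (k ℕ.+ k) ℕ.+ k ℕ.+ 0) ≡ K * K * K * (K * K) * K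
  K⁶′ = trans (cong pow (ℕP.+-identityʳ ((k ℕ.+ k ℕ.+ k) ℕ.+ (k ℕ.+ k) ℕ.+ k))) K⁶
  P⁴K : pow ((m ℕ.+ m) ℕ.+ (k ℕ.+ m) ℕ.+ m) ≡ P * P * (K * P) * P
  P⁴K = trans (pow-+ ((m ℕ.+ m) ℕ.+ (k ℕ.+ m)) m) (cong (_* P) P²KP)
  ring : ∀ u v d a b c {S Q₂ Q₃ Q₄ Q₅ Q₆ Q₇ Q₈ Q₉ Q₁₀}
       → S ≡ K * K * K * K * (P * P) → Q₂ ≡ P * P → Q₃ ≡ K * P → Q₄ ≡ P * P * (K * P)
       → Q₅ ≡ K * K * K → Q₆ ≡ K * K * K * (K * K) → Q₇ ≡ K * K * K * (K * K) * K
       → Q₈ ≡ K * K * K * (K * K) * K → Q₉ ≡ P * P * (K * P) * P → Q₁₀ ≡ K * K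
       → S * (K * K * K * v * v + K * K * P * u * v + d * K * K * K * P * v - P * P * u * u * u
              - a * K * P * P * u * u - b * K * K * P * P * u - c * K * K * K * P * P)
       ≡ 1ℤ * (((v * v * Q₃ + u * v * Q₂) * P + d * v * Q₄) * Q₈
               - ((((u * u * u * Q₁₀ + a * (u * u) * Q₅) * K + b * u * Q₆) * + 1 + c * Q₇)) * Q₉)
  ring u v d a b c refl refl refl refl refl refl refl refl refl refl = solve′ u v d a b c K P
    where
    solve′ : ∀ u v d a b c K P
      → K * K * K * K * (P * P) * (K * K * K * v * v + K * K * P * u * v + d * K * K * K * P * v - P * P * u * u * u
                                   - a * K * P * P * u * u - b * K * K * P * P * u - c * K * K * K * P * P)
      ≡ 1ℤ * (((v * v * (K * P) + u * v * (P * P)) * P + d * v * (P * P * (K * P))) * (K * K * K * (K * K) * K)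
              - ((((u * u * u * (K * K) + a * (u * u) * (K * K * K)) * K + b * u * (K * K * K * (K * K))) * + 1
                 + c * (K * K * K * (K * K) * K))) * (P * P * (K * P) * P))
    solve′ = solve-∀

-- f(x) = (2y + x + δ)² − 4 (y² + xy + δy − x³ − ax² − bx − c)
2-torsion⇒root : ∀ E α β → Is2Torsion E α β → IsRoot E α
2-torsion⇒root E (u /2^ k) (v /2^ m) (on-curve , β≈-β-α-δ) = IsZero₂-cancel-pow (m ℕ.+ m) (divPoly E (u /2^ k)) λ n →
  ∣ᵢ-lincomb₂ n (pow k * seq T n) (- + 4) (T≈0 n) (C≈0 n)
    (trans (cong (_* seq (divPoly E (u /2^ k)) n) (pow-+ m m))
           (ring (seq u n) (seq v n) (δ E) (a E) (b E) (c E) (pow k) (pow m)))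
  where
  T = torsionForm E (u /2^ k) (v /2^ m)
  T≈0 = torsionForm≈0 E (u /2^ k) (v /2^ m) β≈-β-α-δ
  C≈0 = on-curve⇒curveForm≈0 E (u /2^ k) (v /2^ m) on-curve
  ring : ∀ u v d a b c K P
       → P * P * (+ 4 * u * u * u + (1ℤ + + 4 * a) * K * u * u + + 2 * (+ 2 * b + d) * K * K * u + (d * d + + 4 * c) * K * K * K)
       ≡ K * (+ 2 * v * K + u * P + d * P * K) * (+ 2 * v * K + u * P + d * P * K)
         + (- + 4) * (K * K * K * v * v + K * K * P * u * v + d * K * K * K * P * v - P * P * u * u * u
                      - a * K * P * P * u * u - b * K * K * P * P * u - c * K * K * K * P * P)
  ring = solve-∀

-- the cubic form F(u, K) = 2³ᵏ f(u/2ᵏ) satisfies F(uL, KL) − F(u′K, KL) = (uL − u′K) · G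
root-resp-≈ : ∀ E α α′ → α ≈ α′ → IsRoot E α → IsRoot E α′
root-resp-≈ E (u /2^ k) (u′ /2^ l) α≈α′ root = IsZero₂-cancel-pow (k ℕ.+ k ℕ.+ k) (divPoly E (u′ /2^ l)) λ n →
  ∣ᵢ-lincomb₂ n (L * L * L) (- G (seq u n) (seq u′ n)) (root n) (α≈α′ n)
    (trans (cong (_* seq (divPoly E (u′ /2^ l)) n) (pow-*3 k)) (ring (seq u n) (seq u′ n)))
  where
  K = pow k
  L = pow l
  G : ℤ → ℤ → ℤ
  G x y = + 4 * ((x * L) * (x * L) + (x * L) * (y * K) + (y * K) * (y * K))
          + b₂ E * (K * L) * (x * L + y * K) + + 2 * b₄ E * (K * L) * (K * L)
  ring : ∀ x y → K * K * K * (+ 4 * y * y * y + b₂ E * L * y * y + + 2 * b₄ E * L * L * y + b₆ E * L * L * L)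
               ≡ L * L * L * (+ 4 * x * x * x + b₂ E * K * x * x + + 2 * b₄ E * K * K * x + b₆ E * K * K * K)
                 + (- G x y) * (x * L - y * K)
  ring x y = solve′ x y K L (b₂ E) (b₄ E) (b₆ E)
    where
    solve′ : ∀ x y K L B₂ B₄ B₆
      → K * K * K * (+ 4 * y * y * y + B₂ * L * y * y + + 2 * B₄ * L * L * y + B₆ * L * L * L)
      ≡ L * L * L * (+ 4 * x * x * x + B₂ * K * x * x + + 2 * B₄ * K * K * x + B₆ * K * K * K)
        + (- (+ 4 * ((x * L) * (x * L) + (x * L) * (y * K) + (y * K) * (y * K))
              + B₂ * (K * L) * (x * L + y * K) + + 2 * B₄ * (K * L) * (K * L))) * (x * L - y * K)
    solve′ = solve-∀

unit-root⇒den≡4 : ∀ E w s → Odd (seq w 1) → IsRoot E (w /2^ suc s) → s ≡ 1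
unit-root⇒den≡4 E w zero w-odd root = ⊥-elim (pow*odd-∤ᵢ 1 (e (seq w 2) r) (ring (seq w 2) r w₂≡1+2r) (root 2))
  where
  r = proj₁ (odd-seq w w-odd 1)
  w₂≡1+2r = proj₂ (odd-seq w w-odd 1)
  e : ℤ → ℤ → ℤ
  e o r = o * o * o + + 2 * r + + 2 * r * r + + 2 * a E * o * o + + 2 * b₄ E * o + + 2 * b₆ E
  ring : ∀ o r → o ≡ 1ℤ + r * + 2
       → + 4 * o * o * o + b₂ E * + 2 * o * o + + 2 * b₄ E * + 2 * + 2 * o + b₆ E * + 2 * + 2 * + 2
       ≡ + 2 * (1ℤ + e o r * + 2)
  ring o r refl = solve′ r (a E) (b E) (c E) (δ E)
    where
    solve′ : ∀ r a b c d → let o = 1ℤ + r * + 2 in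
         + 4 * o * o * o + (1ℤ + + 4 * a) * + 2 * o * o + + 2 * (+ 2 * b + d) * + 2 * + 2 * o + (d * d + + 4 * c) * + 2 * + 2 * + 2
       ≡ + 2 * (1ℤ + (o * o * o + + 2 * r + + 2 * r * r + + 2 * a * o * o + + 2 * (+ 2 * b + d) * o + + 2 * (d * d + + 4 * c)) * + 2)
    solve′ = solve-∀
unit-root⇒den≡4 E w (suc zero) w-odd root = refl
unit-root⇒den≡4 E w (suc (suc t)) w-odd root = ⊥-elim (pow*odd-∤ᵢ 2 (e (seq w 3) r) (ring (seq w 3) r w₃≡1+2r 2³⁺ᵗ) (root 3))
  where
  r = proj₁ (odd-seq w w-odd 2)
  w₃≡1+2r = proj₂ (odd-seq w w-odd 2)
  e : ℤ → ℤ → ℤ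
  e o r = + 3 * r + + 6 * r * r + + 4 * r * r * r + b₂ E * pow t * o * o
        + + 16 * b₄ E * pow t * pow t * o + + 64 * b₆ E * pow t * pow t * pow t
  2³⁺ᵗ : pow (3 ℕ.+ t) ≡ + 8 * pow t
  2³⁺ᵗ = pow-+ 3 t
  ring : ∀ o r {S} → o ≡ 1ℤ + r * + 2 → S ≡ + 8 * pow t
       → + 4 * o * o * o + b₂ E * S * o * o + + 2 * b₄ E * S * S * o + b₆ E * S * S * S
       ≡ + 4 * (1ℤ + e o r * + 2)
  ring o r refl refl = solve′ r (pow t) (a E) (b E) (c E) (δ E)
    where
    solve′ : ∀ r T a b c d → let o = 1ℤ + r * + 2 in
         + 4 * o * o * o + (1ℤ + + 4 * a) * (+ 8 * T) * o * o + + 2 * (+ 2 * b + d) * (+ 8 * T) * (+ 8 * T) * o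
         + (d * d + + 4 * c) * (+ 8 * T) * (+ 8 * T) * (+ 8 * T)
       ≡ + 4 * (1ℤ + (+ 3 * r + + 6 * r * r + + 4 * r * r * r + (1ℤ + + 4 * a) * T * o * o
                      + + 16 * (+ 2 * b + d) * T * T * o + + 64 * (d * d + + 4 * c) * T * T * T) * + 2)
    solve′ = solve-∀

Unit/4 : ℚ₂ → Set
Unit/4 α = Σ ℤ₂ λ w → Odd (seq w 1) × α ≈ (w /2^ 2)

root⇒∈ℤ₂⊎unit/4 : ∀ E α → IsRoot E α → α ∈ℤ₂ ⊎ Unit/4 α
root⇒∈ℤ₂⊎unit/4 E (u /2^ k) root = by-split (∈ℤ₂⊎unit/2^suc u k)
  where
  by-split : (u /2^ k) ∈ℤ₂ ⊎ Unit/2^suc (u /2^ k) → (u /2^ k) ∈ℤ₂ ⊎ Unit/4 (u /2^ k)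
  by-split (inj₁ α∈ℤ₂) = inj₁ α∈ℤ₂
  by-split (inj₂ (w , s , w-odd , α≈w/2ˢ⁺¹)) = inj₂ (w , w-odd , subst (λ s → (u /2^ k) ≈ (w /2^ suc s)) s≡1 α≈w/2ˢ⁺¹)
    where
    s≡1 = unit-root⇒den≡4 E w s w-odd (root-resp-≈ E (u /2^ k) (w /2^ suc s) α≈w/2ˢ⁺¹ root)

unit/4⇒ord≡-2 : ∀ α → Unit/4 α → ord₂ α ≡ -[1+ 1 ]
unit/4⇒ord≡-2 (u /2^ k) (w , w-odd , α≈w/4) =
  (w , λ n → ∣ᵢ-lincomb₁ n 1ℤ (α≈w/4 n) (ring (seq u n) (seq w n) (pow k))) , ¬ord≥-1
  where
  ring : ∀ u w K → u * + 4 - + 1 * w * K ≡ 1ℤ * (u * + 4 - w * K)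
  ring = solve-∀
  ¬ord≥-1 : ¬ ord₂≥ (u /2^ k) -[1+ 0 ]
  ¬ord≥-1 (z , α≈z/2) = even⇒¬odd (w-even (w≈2z 1)) w-odd
    where
    w/4≈z/2 : (w /2^ 2) ≈ ((ι₂ (+ 1) *₂ z) /2^ 1)
    w/4≈z/2 = ≈-trans {w /2^ 2} {u /2^ k} {(ι₂ (+ 1) *₂ z) /2^ 1} (≈-sym {u /2^ k} {w /2^ 2} α≈w/4) α≈z/2
    w≈2z : IsZero₂ (w -₂ two^₂ 1 *₂ z)
    w≈2z = IsZero₂-cancel-pow 1 (w -₂ two^₂ 1 *₂ z)
             (IsZero₂-resp ((w *₂ two^₂ 1) -₂ (ι₂ (+ 1) *₂ z) *₂ two^₂ 2) (two^₂ 1 *₂ (w -₂ two^₂ 1 *₂ z))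
                           (λ n → ring₂ (seq w n) (seq z n)) w/4≈z/2)
      where
      ring₂ : ∀ w z → + 2 * (w - + 2 * z) ≡ w * + 2 - + 1 * z * + 4
      ring₂ = solve-∀
    w-even : 1 ∣ᵢ (seq w 1 - + 2 * seq z 1) → Even (seq w 1)
    w-even (q , e) = q + seq z 1 , ring₃ (seq w 1) (seq z 1) q e
      where
      ring₃ : ∀ w z q → w - + 2 * z ≡ q * + 2 → w ≡ (q + z) * + 2
      ring₃ w z q e = trans (solve′ w z) (trans (cong (_+ + 2 * z) e) (solve″ q z))
        where
        solve′ : ∀ w z → w ≡ (w - + 2 * z) + + 2 * z
        solve′ = solve-∀
        solve″ : ∀ q z → q * + 2 + + 2 * z ≡ (q + z) * + 2
        solve″ = solve-∀

-- 2-torsion points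

torsion-x-determines-y : ∀ E α₁ β₁ α₂ β₂ → IsZero₂ (torsionForm E α₁ β₁) → IsZero₂ (torsionForm E α₂ β₂)
                       → α₁ ≈ α₂ → β₁ ≈ β₂
torsion-x-determines-y E (u₁ /2^ k₁) (v₁ /2^ m₁) (u₂ /2^ k₂) (v₂ /2^ m₂) T₁≈0 T₂≈0 α₁≈α₂ =
  IsZero₂-cancel-pow (suc (k₁ ℕ.+ k₂)) (v₁ *₂ two^₂ m₂ -₂ v₂ *₂ two^₂ m₁) λ n →
    ∣ᵢ-lincomb₃ n (K₂ * P₂) (- (K₁ * P₁)) (- (P₁ * P₂)) (T₁≈0 n) (T₂≈0 n) (α₁≈α₂ n)
      (trans (cong (_* (seq v₁ n * P₂ - seq v₂ n * P₁)) (trans (pow-suc (k₁ ℕ.+ k₂)) (cong (+ 2 *_) (pow-+ k₁ k₂))))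
             (ring (seq u₁ n) (seq u₂ n) (seq v₁ n) (seq v₂ n) (δ E) K₁ K₂ P₁ P₂))
  where
  K₁ = pow k₁
  K₂ = pow k₂
  P₁ = pow m₁
  P₂ = pow m₂
  ring : ∀ u₁ u₂ v₁ v₂ d K₁ K₂ P₁ P₂ → + 2 * (K₁ * K₂) * (v₁ * P₂ - v₂ * P₁)
       ≡ K₂ * P₂ * (+ 2 * v₁ * K₁ + u₁ * P₁ + d * P₁ * K₁)
         + (- (K₁ * P₁)) * (+ 2 * v₂ * K₂ + u₂ * P₂ + d * P₂ * K₂)
         + (- (P₁ * P₂)) * (u₁ * K₂ - u₂ * K₁)
  ring = solve-∀

∈ℤ₂⇒ord≥-1 : ∀ E α β → IsZero₂ (torsionForm E α β) → α ∈ℤ₂ → ord₂≥ β -[1+ 0 ]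
∈ℤ₂⇒ord≥-1 E (u /2^ k) (v /2^ m) T≈0 (w , α≈w) =
  z , IsZero₂-cancel-pow k (v *₂ two^₂ 1 -₂ (ι₂ (+ 1) *₂ z) *₂ two^₂ m) λ n →
    ∣ᵢ-lincomb₂ n 1ℤ (- pow m) (T≈0 n) (α≈w n) (ring (seq u n) (seq v n) (seq w n) (δ E) (pow k) (pow m))
  where
  z = -₂ (w +₂ ι₂ (δ E))
  ring : ∀ u v w d K P → K * (v * + 2 - + 1 * (- (w + d)) * P)
       ≡ 1ℤ * (+ 2 * v * K + u * P + d * P * K) + (- P) * (u * + 1 - + 1 * w * K)
  ring = solve-∀

ord≥-1⇒∈ℤ₂ : ∀ E α β → IsZero₂ (torsionForm E α β) → ord₂≥ β -[1+ 0 ] → α ∈ℤ₂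
ord≥-1⇒∈ℤ₂ E (u /2^ k) (v /2^ m) T≈0 (z , β≈z/2) =
  w , IsZero₂-cancel-pow m (u *₂ two^₂ 0 -₂ (ι₂ (+ 1) *₂ w) *₂ two^₂ k) λ n →
    ∣ᵢ-lincomb₂ n 1ℤ (- pow k) (T≈0 n) (β≈z/2 n) (ring (seq u n) (seq v n) (seq z n) (δ E) (pow k) (pow m))
  where
  w = -₂ (z +₂ ι₂ (δ E))
  ring : ∀ u v z d K P → P * (u * + 1 - + 1 * (- (z + d)) * K)
       ≡ 1ℤ * (+ 2 * v * K + u * P + d * P * K) + (- K) * (v * + 2 - + 1 * z * P)
  ring = solve-∀

-- 2³ᵏ (f(x/2ᵏ) − f(y/2ᵏ)) / (x − y)
secant : Weierstrass → ℕ → ℤ₂ → ℤ₂ → ℤ₂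
secant E k x y =
  ι₂ (+ 4) *₂ (x *₂ x +₂ x *₂ y +₂ y *₂ y) +₂ ι₂ (b₂ E * K) *₂ (x +₂ y) +₂ ι₂ (+ 2 * b₄ E * K * K)
  where K = pow k

roots⇒secant≈0 : ∀ E k x y → IsRoot E (x /2^ k) → IsRoot E (y /2^ k) → IsZero₂ ((x -₂ y) *₂ secant E k x y)
roots⇒secant≈0 E k x y x-root y-root n =
  ∣ᵢ-lincomb₂ n 1ℤ (- 1ℤ) (x-root n) (y-root n) (ring (seq x n) (seq y n) (pow k) (b₂ E) (b₄ E) (b₆ E))
  where
  ring : ∀ x y K B₂ B₄ B₆
       → (x - y) * (+ 4 * (x * x + x * y + y * y) + B₂ * K * (x + y) + + 2 * B₄ * K * K)
       ≡ 1ℤ * (+ 4 * x * x * x + B₂ * K * x * x + + 2 * B₄ * K * K * x + B₆ * K * K * K)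
         + - 1ℤ * (+ 4 * y * y * y + B₂ * K * y * y + + 2 * B₄ * K * K * y + B₆ * K * K * K)
  ring = solve-∀

-- the secant at two units is 4 times a unit
unit-secant≉0 : ∀ E x y → Odd (seq x 1) → Odd (seq y 1) → ¬ IsZero₂ (secant E 2 x y)
unit-secant≉0 E x y (r , x₁≡1+2r) (s , y₁≡1+2s) S≈0 =
  odd⇒¬IsZero₂ H (h , ring₂ (seq x 1) (seq y 1) x₁≡1+2r y₁≡1+2s)
    (IsZero₂-cancel-pow 2 H (IsZero₂-resp (secant E 2 x y) (two^₂ 2 *₂ H) (λ n → ring₁ (seq x n) (seq y n)) S≈0))
  where
  H = x *₂ x +₂ x *₂ y +₂ y *₂ y +₂ ι₂ (b₂ E) *₂ (x +₂ y) +₂ ι₂ (+ 8 * b₄ E)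
  h = 1ℤ + + 3 * r + + 3 * s + + 2 * r * r + + 2 * r * s + + 2 * s * s + b₂ E * (1ℤ + r + s) + + 4 * b₄ E
  ring₁ : ∀ x y → + 4 * (x * x + x * y + y * y + b₂ E * (x + y) + + 8 * b₄ E)
                ≡ + 4 * (x * x + x * y + y * y) + b₂ E * + 4 * (x + y) + + 2 * b₄ E * + 4 * + 4
  ring₁ x y = solve′ x y (b₂ E) (b₄ E)
    where
    solve′ : ∀ x y B₂ B₄ → + 4 * (x * x + x * y + y * y + B₂ * (x + y) + + 8 * B₄)
                         ≡ + 4 * (x * x + x * y + y * y) + B₂ * + 4 * (x + y) + + 2 * B₄ * + 4 * + 4
    solve′ = solve-∀
  ring₂ : ∀ x y → x ≡ 1ℤ + r * + 2 → y ≡ 1ℤ + s * + 2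
        → x * x + x * y + y * y + b₂ E * (x + y) + + 8 * b₄ E ≡ 1ℤ + h * + 2
  ring₂ x y refl refl = solve′ r s (a E) (b₄ E)
    where
    solve′ : ∀ r s a B₄ → let x = 1ℤ + r * + 2 in let y = 1ℤ + s * + 2 in
        x * x + x * y + y * y + (1ℤ + + 4 * a) * (x + y) + + 8 * B₄
      ≡ 1ℤ + (1ℤ + + 3 * r + + 3 * s + + 2 * r * r + + 2 * r * s + + 2 * s * s + (1ℤ + + 4 * a) * (1ℤ + r + s) + + 4 * B₄) * + 2
    solve′ = solve-∀

unit/4-roots-coincide : ∀ E α₁ α₂ → IsRoot E α₁ → IsRoot E α₂ → Unit/4 α₁ → Unit/4 α₂ → α₁ ≈ α₂
unit/4-roots-coincide E α₁ α₂ root₁ root₂ (w₁ , w₁-odd , α₁≈w₁/4) (w₂ , w₂-odd , α₂≈w₂/4) =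
  ≈-via-≈₂ {α₁} {α₂} {w₁} {w₂} 2 α₁≈w₁/4 α₂≈w₂/4 w₁≈w₂
  where
  w₁≈w₂ : w₁ ≈₂ w₂
  w₁≈w₂ = IsZero₂-*-cancelʳ (w₁ -₂ w₂) (secant E 2 w₁ w₂) (unit-secant≉0 E w₁ w₂ w₁-odd w₂-odd)
            (roots⇒secant≈0 E 2 w₁ w₂ (root-resp-≈ E α₁ (w₁ /2^ 2) α₁≈w₁/4 root₁)
                                (root-resp-≈ E α₂ (w₂ /2^ 2) α₂≈w₂/4 root₂))

-- secant(x₁, x₂) − secant(x₁, x₃) = (x₂ − x₃) (4 (x₁ + x₂ + x₃) + b₂), and b₂ is odd
at-most-two-integral-roots : ∀ E x₁ x₂ x₃ → IsRoot E (x₁ /2^ 0) → IsRoot E (x₂ /2^ 0) → IsRoot E (x₃ /2^ 0)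
                           → ¬ x₁ ≈₂ x₂ → ¬ x₁ ≈₂ x₃ → x₂ ≈₂ x₃
at-most-two-integral-roots E x₁ x₂ x₃ root₁ root₂ root₃ x₁≉x₂ x₁≉x₃ =
  IsZero₂-*-cancelʳ (x₂ -₂ x₃) h (odd⇒¬IsZero₂ h (+ 2 * s₁ + + 2 * a E , ring₁ s₁ (a E)))
    λ n → ∣ᵢ-lincomb₂ n 1ℤ (- 1ℤ) (S₁₂≈0 n) (S₁₃≈0 n) (ring₂ (seq x₁ n) (seq x₂ n) (seq x₃ n) (b₂ E) (b₄ E))
  where
  h = ι₂ (+ 4) *₂ (x₁ +₂ x₂ +₂ x₃) +₂ ι₂ (b₂ E)
  s₁ = seq x₁ 1 + seq x₂ 1 + seq x₃ 1
  S₁₂≈0 = IsZero₂-*-cancelˡ (x₁ -₂ x₂) (secant E 0 x₁ x₂) x₁≉x₂ (roots⇒secant≈0 E 0 x₁ x₂ root₁ root₂)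
  S₁₃≈0 = IsZero₂-*-cancelˡ (x₁ -₂ x₃) (secant E 0 x₁ x₃) x₁≉x₃ (roots⇒secant≈0 E 0 x₁ x₃ root₁ root₃)
  ring₁ : ∀ s a → + 4 * s + (1ℤ + + 4 * a) ≡ 1ℤ + (+ 2 * s + + 2 * a) * + 2
  ring₁ = solve-∀
  ring₂ : ∀ x₁ x₂ x₃ B₂ B₄ → (x₂ - x₃) * (+ 4 * (x₁ + x₂ + x₃) + B₂)
        ≡ 1ℤ * (+ 4 * (x₁ * x₁ + x₁ * x₂ + x₂ * x₂) + B₂ * + 1 * (x₁ + x₂) + + 2 * B₄ * + 1 * + 1)
          + - 1ℤ * (+ 4 * (x₁ * x₁ + x₁ * x₃ + x₃ * x₃) + B₂ * + 1 * (x₁ + x₃) + + 2 * B₄ * + 1 * + 1)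
  ring₂ = solve-∀

torsion-x-distinct : ∀ E α₁ β₁ α₂ β₂ → Is2Torsion E α₁ β₁ → Is2Torsion E α₂ β₂
                   → DistinctPts α₁ β₁ α₂ β₂ → ¬ α₁ ≈ α₂
torsion-x-distinct E α₁ β₁ α₂ β₂ (_ , t₁) (_ , t₂) P₁≢P₂ α₁≈α₂ =
  P₁≢P₂ (α₁≈α₂ , torsion-x-determines-y E α₁ β₁ α₂ β₂ (torsionForm≈0 E α₁ β₁ t₁) (torsionForm≈0 E α₂ β₂ t₂) α₁≈α₂)

unit/4-torsion-unique : ∀ E α₁ β₁ α β → Is2Torsion E α₁ β₁ → Is2Torsion E α β → DistinctPts α₁ β₁ α β
                      → Unit/4 α₁ → α ∈ℤ₂
unit/4-torsion-unique E α₁ β₁ α β P₁ P P₁≢P α₁-unit/4 = by-cases (root⇒∈ℤ₂⊎unit/4 E α α-root)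
  where
  α-root = 2-torsion⇒root E α β P
  by-cases : α ∈ℤ₂ ⊎ Unit/4 α → α ∈ℤ₂
  by-cases (inj₁ α∈ℤ₂) = α∈ℤ₂
  by-cases (inj₂ α-unit/4) = ⊥-elim (torsion-x-distinct E α₁ β₁ α β P₁ P P₁≢P
    (unit/4-roots-coincide E α₁ α (2-torsion⇒root E α₁ β₁ P₁) α-root α₁-unit/4 α-unit/4))

no-three-integral-torsion-points : ∀ E α₁ β₁ α₂ β₂ α₃ β₃
  → Is2Torsion E α₁ β₁ → Is2Torsion E α₂ β₂ → Is2Torsion E α₃ β₃
  → DistinctPts α₁ β₁ α₂ β₂ → DistinctPts α₁ β₁ α₃ β₃ → DistinctPts α₂ β₂ α₃ β₃
  → α₁ ∈ℤ₂ → α₂ ∈ℤ₂ → α₃ ∈ℤ₂ → ⊥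
no-three-integral-torsion-points E α₁ β₁ α₂ β₂ α₃ β₃ P₁ P₂ P₃ P₁≢P₂ P₁≢P₃ P₂≢P₃
                                 (w₁ , α₁≈x₁) (w₂ , α₂≈x₂) (w₃ , α₃≈x₃) =
  x≉ α₂ β₂ α₃ β₃ x₂ x₃ P₂ P₃ P₂≢P₃ α₂≈x₂ α₃≈x₃
    (at-most-two-integral-roots E x₁ x₂ x₃ (root α₁ β₁ x₁ P₁ α₁≈x₁) (root α₂ β₂ x₂ P₂ α₂≈x₂) (root α₃ β₃ x₃ P₃ α₃≈x₃)
      (x≉ α₁ β₁ α₂ β₂ x₁ x₂ P₁ P₂ P₁≢P₂ α₁≈x₁ α₂≈x₂)
      (x≉ α₁ β₁ α₃ β₃ x₁ x₃ P₁ P₃ P₁≢P₃ α₁≈x₁ α₃≈x₃))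
  where
  x₁ = num (2^ 0ℤ D.* ⟦ w₁ ⟧₂)
  x₂ = num (2^ 0ℤ D.* ⟦ w₂ ⟧₂)
  x₃ = num (2^ 0ℤ D.* ⟦ w₃ ⟧₂)
  root : ∀ α β x → Is2Torsion E α β → α ≈ (x /2^ 0) → IsRoot E (x /2^ 0)
  root α β x P α≈x = root-resp-≈ E α (x /2^ 0) α≈x (2-torsion⇒root E α β P)
  x≉ : ∀ α β α′ β′ x x′ → Is2Torsion E α β → Is2Torsion E α′ β′ → DistinctPts α β α′ β′
     → α ≈ (x /2^ 0) → α′ ≈ (x′ /2^ 0) → ¬ x ≈₂ x′
  x≉ α β α′ β′ x x′ P P′ P≢P′ α≈x α′≈x′ x≈x′ =
    torsion-x-distinct E α β α′ β′ P P′ P≢P′ (≈-via-≈₂ {α} {α′} {x} {x′} 0 α≈x α′≈x′ x≈x′)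

lemma5p2 : (E : Weierstrass)
    → (δ E ≡ + 0 ⊎ δ E ≡ + 1)
    → IsMinimal E
    → GoodAt2 E
    → (α₁ β₁ α₂ β₂ α₃ β₃ : ℚ₂)
    → Is2Torsion E α₁ β₁ → Is2Torsion E α₂ β₂ → Is2Torsion E α₃ β₃
    → DistinctPts α₁ β₁ α₂ β₂ → DistinctPts α₁ β₁ α₃ β₃ → DistinctPts α₂ β₂ α₃ β₃
    → ((x y : ℚ₂) → Is2Torsion E x y
    → (x ≈ α₁ × y ≈ β₁) ⊎ (x ≈ α₂ × y ≈ β₂) ⊎ (x ≈ α₃ × y ≈ β₃))
    → ord₂ β₁ ≤ord₂ β₂
    → ord₂ β₂ ≤ord₂ β₃
    → (ord₂ α₁ ≡ -[1+ 1 ]) × (α₂ ∈ℤ₂) × (α₃ ∈ℤ₂)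
lemma5p2 E _ _ _ α₁ β₁ α₂ β₂ α₃ β₃ P₁ P₂ P₃ P₁≢P₂ P₁≢P₃ P₂≢P₃ _ β₁≤β₂ β₂≤β₃ =
  by-cases (root⇒∈ℤ₂⊎unit/4 E α₁ (2-torsion⇒root E α₁ β₁ P₁))
  where
  by-cases : α₁ ∈ℤ₂ ⊎ Unit/4 α₁ → (ord₂ α₁ ≡ -[1+ 1 ]) × (α₂ ∈ℤ₂) × (α₃ ∈ℤ₂)
  by-cases (inj₂ α₁-unit/4) = unit/4⇒ord≡-2 α₁ α₁-unit/4
                             , unit/4-torsion-unique E α₁ β₁ α₂ β₂ P₁ P₂ P₁≢P₂ α₁-unit/4
                             , unit/4-torsion-unique E α₁ β₁ α₃ β₃ P₁ P₃ P₁≢P₃ α₁-unit/4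
  by-cases (inj₁ α₁∈ℤ₂) =
    ⊥-elim (no-three-integral-torsion-points E α₁ β₁ α₂ β₂ α₃ β₃ P₁ P₂ P₃ P₁≢P₂ P₁≢P₃ P₂≢P₃
                                              α₁∈ℤ₂ α₂∈ℤ₂ α₃∈ℤ₂)
    where
    β₁≥-1 = ∈ℤ₂⇒ord≥-1 E α₁ β₁ (torsionForm≈0 E α₁ β₁ (proj₂ P₁)) α₁∈ℤ₂
    β₂≥-1 = β₁≤β₂ -[1+ 0 ] β₁≥-1
    α₂∈ℤ₂ = ord≥-1⇒∈ℤ₂ E α₂ β₂ (torsionForm≈0 E α₂ β₂ (proj₂ P₂)) β₂≥-1
    α₃∈ℤ₂ = ord≥-1⇒∈ℤ₂ E α₃ β₃ (torsionForm≈0 E α₃ β₃ (proj₂ P₃)) (β₂≤β₃ -[1+ 0 ] β₂≥-1)
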